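{- Let $G$ be a $6$-minimal graph with maximum degree at most $3$ and girth at least $7$. Then $G$ does not contain two adjacent vertices $v_1,v_2$ of degree $3$ each of which is of class $2$.
   Context: All graphs are finite and simple. The square $G^2$ of $G$ has vertex set $V(G)$, with two vertices adjacent if their distance in $G$ is at most $2$. A graph is $k$-choosable if it admits a proper coloring from any assignment of lists of size $k$. A graph $G$ is $k$-minimal if $G^2$ is not $k$-choosable but $H^2$ is $k$-choosable for every proper subgraph $H$ of $G$. A vertex of degree $3$ is of class $i$ if it is adjacent to exactly $i$ vertices of degree $2$. -}

module Defs where

open import Data.Bool using (Bool; true; false; if_then_else_)
open import Data.Nat using (ℕ; zero; suc; _≤_; _<_; _≡ᵇ_)
open import Data.Fin using (Fin)
open import Data.List using (List; length; map; allFin)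
open import Data.Nat.ListAction using (sum)
open import Data.List.Membership.Propositional using (_∈_)
open import Data.List.Relation.Unary.Unique.Propositional using (Unique)
open import Data.Product using (Σ; ∃; _×_)
open import Data.Sum using (_⊎_)
open import Relation.Binary.PropositionalEquality using (_≡_; _≢_)
open import Relation.Nullary using (¬_)

record Graph (n : ℕ) : Set where
  field
    adj   : Fin n → Fin n → Bool
    sym   : ∀ u v → adj u v ≡ adj v u
    loopless : ∀ v → adj v v ≡ false
open Graph public

record Subgraph {n : ℕ} (G : Graph n) : Set where
  field
    vs : Fin n → Bool
    es : Fin n → Fin n → Bool
    es-sym : ∀ u v → es u v ≡ es v u
    es⊆adj : ∀ u v → es u v ≡ true → adj G u v ≡ true
    es-vs  : ∀ u v → es u v ≡ true → vs u ≡ true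
open Subgraph public

Proper : ∀ {n} {G : Graph n} → Subgraph G → Set
Proper {n} {G} H =
  (Σ (Fin n) λ v → vs H v ≡ false)
  ⊎ (Σ (Fin n) λ u → Σ (Fin n) λ v → adj G u v ≡ true × es H u v ≡ false)

SqAdj : ∀ {n} → (Fin n → Fin n → Bool) → Fin n → Fin n → Set
SqAdj {n} e u v =
  u ≢ v × (e u v ≡ true ⊎ Σ (Fin n) λ w → e u w ≡ true × e w v ≡ true)

SqChoosable : ∀ {n} → ℕ → (Fin n → Bool) → (Fin n → Fin n → Bool) → Set
SqChoosable {n} k vset e =
  (L : Fin n → List ℕ) →
  (∀ v → vset v ≡ true → length (L v) ≡ k × Unique (L v)) →
  Σ (Fin n → ℕ) λ c →
    (∀ v → vset v ≡ true → c v ∈ L v) ×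
    (∀ u v → vset u ≡ true → vset v ≡ true → SqAdj e u v → c u ≢ c v)

SquareChoosable : ∀ {n} → ℕ → Graph n → Set
SquareChoosable k G = SqChoosable k (λ _ → true) (adj G)

SubSquareChoosable : ∀ {n} {G : Graph n} → ℕ → Subgraph G → Set
SubSquareChoosable k H = SqChoosable k (vs H) (es H)

Minimal : ∀ {n} → ℕ → Graph n → Set
Minimal k G =
  ¬ SquareChoosable k G ×
  (∀ (H : Subgraph G) → Proper H → SubSquareChoosable k H)

deg : ∀ {n} → Graph n → Fin n → ℕ
deg {n} G v = sum (map (λ u → if adj G v u then 1 else 0) (allFin n))

MaxDegAtMost : ∀ {n} → ℕ → Graph n → Set
MaxDegAtMost {n} d G = ∀ (v : Fin n) → deg G v ≤ d

IsCycle : ∀ {n} → Graph n → (l : ℕ) → (ℕ → Fin n) → Set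
IsCycle G l f =
  3 ≤ l ×
  (∀ i → i < l → adj G (f i) (f (suc i)) ≡ true) ×
  f l ≡ f 0 ×
  (∀ i j → i < l → j < l → f i ≡ f j → i ≡ j)

-- Girth at least g (acyclic graphs have infinite girth).
GirthAtLeast : ∀ {n} → ℕ → Graph n → Set
GirthAtLeast g G = ∀ l f → IsCycle G l f → g ≤ l

deg2Nbrs : ∀ {n} → Graph n → Fin n → ℕ
deg2Nbrs {n} G v =
  sum (map (λ u → if adj G v u then (if deg G u ≡ᵇ 2 then 1 else 0) else 0)
           (allFin n))

OfClass : ∀ {n} → Graph n → ℕ → Fin n → Set
OfClass G i v = deg G v ≡ 3 × deg2Nbrs G v ≡ i

module Submission where

open import Data.Bool using (Bool; true; false; T?; not; _∧_; if_then_else_)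
open import Data.Bool.Properties using (T-≡; ∧-comm)
open import Data.Fin using (Fin) renaming (_≟_ to _≟ᶠ_)
open import Data.Fin.Patterns using (0F; 1F)
open import Data.List using (List; []; _∷_; _++_; length; map; filter; filterᵇ; allFin)
open import Data.List.Properties using (filter-notAll; length-map)
open import Data.List.Membership.Propositional using (_∈_; _∉_; lose)
open import Data.List.Membership.Propositional.Properties using (∈-filter⁺; ∈-filter⁻; ∈-map⁺; ∈-allFin)
open import Data.List.Relation.Binary.Subset.Propositional using (_⊆_)
open import Data.List.Relation.Unary.All as All using (_∷_; [])
open import Data.List.Relation.Unary.AllPairs using (_∷_)
open import Data.List.Relation.Unary.Any as Any using (here; there)
open import Data.List.Relation.Unary.Linked using (Linked; [-]; _∷_)
open import Data.List.Relation.Unary.Unique.Propositional using (Unique; [])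
open import Data.List.Relation.Unary.Unique.Propositional.Properties using (allFin⁺; filter⁺)
open import Data.Nat using (ℕ; zero; suc; _+_; _≤_; _<_; _≡ᵇ_; z≤n; s≤s; s≤s⁻¹)
import Data.Nat as ℕ
open import Data.Nat.ListAction using (sum)
open import Data.Nat.Properties
  using (≤-trans; ≤-refl; <-≤-trans; ≮⇒≥; m≤n+m; n≤1+n; +-suc; +-monoʳ-≤; ≡ᵇ⇒≡; _≤?_)
open import Data.Product using (Σ; ∃-syntax; _×_; _,_; proj₁; proj₂)
open import Data.Sum using (_⊎_; inj₁; inj₂; [_,_])
open import Function using (_∘_)
open import Function.Bundles using (Equivalence)
open import Relation.Binary.Definitions using (DecidableEquality)
open import Relation.Binary.PropositionalEquality
  using (_≡_; _≢_; refl; sym; trans; cong; cong₂; subst; subst₂; module ≡-Reasoning)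
open import Relation.Nullary using (¬_; yes; no; does; ¬?; contradiction)
open import Relation.Nullary.Decidable as Dec using (from-no)
open import Relation.Unary using (Decidable)

open import Defs hiding (sym)

-- Delete the six vertices v₁, v₂ and their degree-2 neighbours a, b (of v₁) and c, d (of v₂), and
-- colour the square of the rest by minimality.  In G² each deleted vertex then sees at most two
-- (hubs) or three (leaves) coloured vertices, leaving it at least 4 resp. 3 of its 6 colours.
-- Since the girth is at least 6, {a, b} and {c, d} are at distance 3, so the deleted vertices
-- induce in G² two K₄'s sharing the edge v₁v₂; this graph is choosable from lists of sizes
-- 4, 4, 3, 3, 3, 3, which gives a colouring of G², contradicting minimality.

module _ {A : Set} where

  sum-map-if : ∀ (p : A → Bool) (f : A → ℕ) xs →
    sum (map (λ x → if p x then f x else 0) xs) ≡ sum (map f (filterᵇ p xs))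
  sum-map-if p f [] = refl
  sum-map-if p f (x ∷ xs) with p x
  ... | true  = cong (f x +_) (sum-map-if p f xs)
  ... | false = sum-map-if p f xs

  sum-map-one : ∀ (xs : List A) → sum (map (λ _ → 1) xs) ≡ length xs
  sum-map-one [] = refl
  sum-map-one (x ∷ xs) = cong suc (sum-map-one xs)

  -- at d xs i is the i-th entry of xs, and d past its end.
  at : A → List A → ℕ → A
  at d []       _       = d
  at d (x ∷ xs) zero    = x
  at d (x ∷ xs) (suc i) = at d xs i

  at-length : ∀ d xs → at d xs (length xs) ≡ d
  at-length d []       = refl
  at-length d (x ∷ xs) = at-length d xs

  at-∈ : ∀ d {xs i} → i < length xs → at d xs i ∈ xs
  at-∈ d {x ∷ xs} {zero}  _       = here refl
  at-∈ d {x ∷ xs} {suc i} (s≤s i<) = there (at-∈ d i<)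

  at-injective : ∀ d {xs} → Unique xs → ∀ {i j} → i < length xs → j < length xs →
                 at d xs i ≡ at d xs j → i ≡ j
  at-injective d (x∉ ∷ u) {zero}  {zero}  _        _        _  = refl
  at-injective d (x∉ ∷ u) {zero}  {suc j} _        (s≤s j<) eq = contradiction eq (All.lookup x∉ (at-∈ d j<))
  at-injective d (x∉ ∷ u) {suc i} {zero}  (s≤s i<) _        eq = contradiction (sym eq) (All.lookup x∉ (at-∈ d i<))
  at-injective d (x∉ ∷ u) {suc i} {suc j} (s≤s i<) (s≤s j<) eq = cong suc (at-injective d u i< j< eq)

  at-linked : ∀ {R : A → A → Set} d {xs} → Linked R (xs ++ d ∷ []) → ∀ {i} → i < length xs →
              R (at d xs i) (at d xs (suc i))
  at-linked d {x ∷ []}     (r ∷ [-]) {zero} _        = r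
  at-linked d {x ∷ []}     (r ∷ [-]) {suc i} (s≤s ())
  at-linked d {x ∷ y ∷ ys} (r ∷ rs)  {zero} _        = r
  at-linked d {x ∷ y ∷ ys} (r ∷ rs)  {suc i} (s≤s i<) = at-linked d rs i<


module ListChoice {A : Set} (_≟_ : DecidableEquality A) where

  remove : A → List A → List A
  remove x = filter (¬? ∘ (x ≟_))

  length-remove< : ∀ {x ys} → x ∈ ys → length (remove x ys) < length ys
  length-remove< {x} {ys} x∈ys = filter-notAll (¬? ∘ (x ≟_)) ys (Any.map (λ x≡y x≢y → x≢y x≡y) x∈ys)

  ∈-remove⁺ : ∀ {x y ys} → y ∈ ys → x ≢ y → y ∈ remove x ys
  ∈-remove⁺ {x} = ∈-filter⁺ (¬? ∘ (x ≟_))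

  ∃∈-∉ : ∀ {xs ys : List A} → Unique xs → length ys < length xs → ∃[ z ] z ∈ xs × z ∉ ys
  ∃∈-∉ {x ∷ xs} {ys} (x∉xs ∷ unique) ys< with Any.any? (x ≟_) ys
  ... | no x∉ys  = x , here refl , x∉ys
  ... | yes x∈ys with ∃∈-∉ unique (<-≤-trans (length-remove< x∈ys) (s≤s⁻¹ ys<))
  ...   | z , z∈xs , z∉ys∖x = z , there z∈xs , λ z∈ys → z∉ys∖x (∈-remove⁺ z∈ys (All.lookup x∉xs z∈xs))

  unique-⊆⇒length≤ : ∀ {xs ys : List A} → Unique xs → xs ⊆ ys → length xs ≤ length ys
  unique-⊆⇒length≤ u xs⊆ys = ≮⇒≥ λ ys< → let z , z∈xs , z∉ys = ∃∈-∉ u ys< in z∉ys (xs⊆ys z∈xs)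

  record Selection (k : ℕ) (xs ys : List A) : Set where
    field
      elems        : List A
      length-elems : length elems ≡ k
      elems-unique : Unique elems
      elems⊆       : elems ⊆ xs
      elems∉       : ∀ {z} → z ∈ elems → z ∉ ys

  select : ∀ k {xs} ys → Unique xs → k + length ys ≤ length xs → Selection k xs ys
  select zero    ys _ _ =
    record { elems = [] ; length-elems = refl ; elems-unique = [] ; elems⊆ = λ () ; elems∉ = λ () }
  select (suc k) {xs} ys unique k+ys≤ with ∃∈-∉ {ys = ys} unique (≤-trans (s≤s (m≤n+m _ k)) k+ys≤)
  ... | z , z∈xs , z∉ys = record
    { elems        = z ∷ elems
    ; length-elems = cong suc length-elems
    ; elems-unique = All.tabulate (λ w∈ z≡w → elems∉ w∈ (here (sym z≡w))) ∷ elems-unique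
    ; elems⊆       = λ { (here refl) → z∈xs ; (there w∈) → elems⊆ w∈ }
    ; elems∉       = λ { (here refl) → z∉ys ; (there w∈) → elems∉ w∈ ∘ there }
    }
    where
    open Selection (select k (z ∷ ys) unique (subst (_≤ length xs) (sym (+-suc k (length ys))) k+ys≤))

-- Positions in the configuration: hub h stands for v₁ or v₂, leaf s t for the degree-2 neighbours
-- of hub s.  Clash lists the pairs of positions within distance 2 of each other.
data Slot : Set where
  hub  : Fin 2 → Slot
  leaf : Fin 2 → Fin 2 → Slot

data Clash : Slot → Slot → Set where
  hub-hub   : Clash (hub 0F) (hub 1F)
  hub-leaf  : ∀ h s t → Clash (hub h) (leaf s t)
  leaf-leaf : ∀ s → Clash (leaf s 0F) (leaf s 1F)

-- 6 minus the number of already coloured vertices a position sees in G².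
slotSize : Slot → ℕ
slotSize (hub _)    = 4
slotSize (leaf _ _) = 3

module TwinK₄ {A : Set} (_≟_ : DecidableEquality A) where

  open ListChoice _≟_
  open import Data.List.Membership.DecPropositional _≟_ using (_∈?_)

  module _ (Av : Slot → List A) (unique : ∀ i → Unique (Av i))
           (size : ∀ i → length (Av i) ≡ slotSize i) where

    private
      pick : ∀ i ys → length ys < slotSize i → ∃[ z ] z ∈ Av i × z ∉ ys
      pick i ys ys< = ∃∈-∉ (unique i) (subst (length ys <_) (sym (size i)) ys<)

      leaf<hub : ∀ h s t → length (Av (leaf s t)) < slotSize (hub h)
      leaf<hub h s t = subst (_< 4) (sym (size (leaf s t))) ≤-refl

      ∉-pair : ∀ {z a b : A} → z ≢ a → z ≢ b → z ∉ a ∷ b ∷ []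
      ∉-pair z≢a z≢b (here z≡a)         = z≢a z≡a
      ∉-pair z≢a z≢b (there (here z≡b)) = z≢b z≡b

      ∈-∉⇒≢ : ∀ {z w : A} {xs} → z ∈ xs → w ∉ xs → z ≢ w
      ∈-∉⇒≢ z∈ w∉ refl = w∉ z∈

      -- Hub 0 or hub 1 gets a colour outside the list of leaf 1 0, so that leaf keeps a spare colour.
      y-step : ∀ x → ∃[ y ] y ∈ Av (hub 1F) × x ≢ y × (x ∉ Av (leaf 1F 0F) ⊎ y ∉ Av (leaf 1F 0F))
      y-step x with x ∈? Av (leaf 1F 0F)
      ... | yes x∈ = let y , y∈ , y∉ = pick (hub 1F) (Av (leaf 1F 0F)) (leaf<hub 1F 1F 0F)
                     in y , y∈ , ∈-∉⇒≢ x∈ y∉ , inj₂ y∉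
      ... | no x∉  = let y , y∈ , y∉ = pick (hub 1F) (x ∷ []) (s≤s (s≤s z≤n))
                     in y , y∈ , (λ x≡y → y∉ (here (sym x≡y))) , inj₁ x∉

      γ-step : ∀ {x y} δ → x ∉ Av (leaf 1F 0F) ⊎ y ∉ Av (leaf 1F 0F) →
               ∃[ γ ] γ ∈ Av (leaf 1F 0F) × γ ∉ x ∷ y ∷ [] × γ ≢ δ
      γ-step {x} {y} δ (inj₁ x∉) =
        let γ , γ∈ , γ∉ = pick (leaf 1F 0F) (y ∷ δ ∷ []) ≤-refl
        in γ , γ∈ , ∉-pair (∈-∉⇒≢ γ∈ x∉) (γ∉ ∘ here) , γ∉ ∘ there ∘ here
      γ-step {x} {y} δ (inj₂ y∉) =
        let γ , γ∈ , γ∉ = pick (leaf 1F 0F) (x ∷ δ ∷ []) ≤-refl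
        in γ , γ∈ , ∉-pair (γ∉ ∘ here) (∈-∉⇒≢ γ∈ y∉) , γ∉ ∘ there ∘ here

    -- Hub 0 gets a colour outside the list of leaf 0 0, so that leaf keeps a spare colour.
    twinK₄-choosable : Σ (Slot → A) λ col → (∀ i → col i ∈ Av i) × (∀ {i j} → Clash i j → col i ≢ col j)
    twinK₄-choosable
      with pick (hub 0F) (Av (leaf 0F 0F)) (leaf<hub 0F 0F 0F)
    ... | x , x∈ , x∉ with y-step x
    ... | y , y∈ , x≢y , spare with pick (leaf 0F 1F) (x ∷ y ∷ []) ≤-refl
    ... | β , β∈ , β∉ with pick (leaf 0F 0F) (y ∷ β ∷ []) ≤-refl
    ... | α , α∈ , α∉ with pick (leaf 1F 1F) (x ∷ y ∷ []) ≤-refl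
    ... | δ , δ∈ , δ∉ with γ-step δ spare
    ... | γ , γ∈ , γ∉ , γ≢δ = col , col∈ , proper
      where
      col : Slot → A
      col (hub 0F)     = x
      col (hub 1F)     = y
      col (leaf 0F 0F) = α
      col (leaf 0F 1F) = β
      col (leaf 1F 0F) = γ
      col (leaf 1F 1F) = δ

      col∈ : ∀ i → col i ∈ Av i
      col∈ (hub 0F)     = x∈
      col∈ (hub 1F)     = y∈
      col∈ (leaf 0F 0F) = α∈
      col∈ (leaf 0F 1F) = β∈
      col∈ (leaf 1F 0F) = γ∈
      col∈ (leaf 1F 1F) = δ∈

      leaf∉hubs : ∀ s t → col (leaf s t) ∉ x ∷ y ∷ []
      leaf∉hubs 0F 0F = ∉-pair (∈-∉⇒≢ α∈ x∉) (α∉ ∘ here)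
      leaf∉hubs 0F 1F = β∉
      leaf∉hubs 1F 0F = γ∉
      leaf∉hubs 1F 1F = δ∉

      proper : ∀ {i j} → Clash i j → col i ≢ col j
      proper hub-hub           = x≢y
      proper (hub-leaf 0F s t) = leaf∉hubs s t ∘ here ∘ sym
      proper (hub-leaf 1F s t) = leaf∉hubs s t ∘ there ∘ here ∘ sym
      proper (leaf-leaf 0F)    = α∉ ∘ there ∘ here
      proper (leaf-leaf 1F)    = γ≢δ

module Neighbourhoods {n} (G : Graph n) where

  open ListChoice (_≟ᶠ_ {n})

  infix 4 _∼_
  _∼_ : Fin n → Fin n → Set
  u ∼ v = adj G u v ≡ true

  ∼-sym : ∀ {u v} → u ∼ v → v ∼ u
  ∼-sym {u} {v} u∼v = trans (Graph.sym G v u) u∼v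

  ∼-irrefl : ∀ {u v} → u ∼ v → u ≢ v
  ∼-irrefl {u} u∼u refl with trans (sym u∼u) (loopless G u)
  ... | ()

  SqAdj-sym : ∀ {u v} → SqAdj (adj G) u v → SqAdj (adj G) v u
  SqAdj-sym (u≢v , inj₁ u∼v)             = u≢v ∘ sym , inj₁ (∼-sym u∼v)
  SqAdj-sym (u≢v , inj₂ (w , u∼w , w∼v)) = u≢v ∘ sym , inj₂ (w , ∼-sym w∼v , ∼-sym u∼w)

  nbrs : Fin n → List (Fin n)
  nbrs v = filterᵇ (adj G v) (allFin n)

  nbrs-unique : ∀ v → Unique (nbrs v)
  nbrs-unique v = filter⁺ (T? ∘ adj G v) (allFin⁺ n)

  ∈-nbrs⁺ : ∀ {v u} → v ∼ u → u ∈ nbrs v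
  ∈-nbrs⁺ {v} {u} v∼u = ∈-filter⁺ (T? ∘ adj G v) (∈-allFin u) (Equivalence.from T-≡ v∼u)

  ∈-nbrs⁻ : ∀ {v u} → u ∈ nbrs v → v ∼ u
  ∈-nbrs⁻ {v} u∈ = Equivalence.to T-≡ (proj₂ (∈-filter⁻ (T? ∘ adj G v) {xs = allFin n} u∈))

  deg≡length-nbrs : ∀ v → deg G v ≡ length (nbrs v)
  deg≡length-nbrs v = trans (sum-map-if (adj G v) (λ _ → 1) (allFin n)) (sum-map-one (nbrs v))

  length≤deg : ∀ {v us} → Unique us → (∀ {u} → u ∈ us → v ∼ u) → length us ≤ deg G v
  length≤deg {v} u-us v∼us = subst (_ ≤_) (sym (deg≡length-nbrs v)) (unique-⊆⇒length≤ u-us (∈-nbrs⁺ ∘ v∼us))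

  deg₂ : Fin n → Bool
  deg₂ u = deg G u ≡ᵇ 2

  nbrs₂ : Fin n → List (Fin n)
  nbrs₂ v = filterᵇ deg₂ (nbrs v)

  nbrs₂-unique : ∀ v → Unique (nbrs₂ v)
  nbrs₂-unique v = filter⁺ (T? ∘ deg₂) (nbrs-unique v)

  ∈-nbrs₂⁻ : ∀ {v u} → u ∈ nbrs₂ v → v ∼ u × deg G u ≡ 2
  ∈-nbrs₂⁻ {v} {u} u∈ with ∈-filter⁻ (T? ∘ deg₂) {xs = nbrs v} u∈
  ... | u∈nbrs , deg₂-u = ∈-nbrs⁻ u∈nbrs , ≡ᵇ⇒≡ (deg G u) 2 deg₂-u

  deg2Nbrs≡length : ∀ v → deg2Nbrs G v ≡ length (nbrs₂ v)
  deg2Nbrs≡length v = begin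
    deg2Nbrs G v                                       ≡⟨ sum-map-if (adj G v) (λ u → if deg₂ u then 1 else 0) (allFin n) ⟩
    sum (map (λ u → if deg₂ u then 1 else 0) (nbrs v)) ≡⟨ sum-map-if deg₂ (λ _ → 1) (nbrs v) ⟩
    sum (map (λ _ → 1) (nbrs₂ v))                      ≡⟨ sum-map-one (nbrs₂ v) ⟩
    length (nbrs₂ v)                                   ∎
    where open ≡-Reasoning

  deg-3≢2 : ∀ {u w} → deg G u ≡ 3 → deg G w ≡ 2 → u ≢ w
  deg-3≢2 d3 d2 refl with trans (sym d3) d2
  ... | ()

  record OtherNeighbour (x v : Fin n) : Set where
    field
      far       : Fin n
      x∼far     : x ∼ far
      nbr-cases : ∀ {z} → x ∼ z → z ≡ v ⊎ z ≡ far

  otherNeighbour : ∀ {x v} → deg G x ≡ 2 → x ∼ v → OtherNeighbour x v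
  otherNeighbour {x} {v} deg-x x∼v
    with ∃∈-∉ {ys = v ∷ []} (nbrs-unique x) (subst (1 <_) (trans (sym deg-x) (deg≡length-nbrs x)) ≤-refl)
  ... | y , y∈ , y∉ = record { far = y ; x∼far = ∈-nbrs⁻ y∈ ; nbr-cases = nbr-cases }
    where
    y≢v : y ≢ v
    y≢v y≡v = y∉ (here y≡v)
    nbr-cases : ∀ {z} → x ∼ z → z ≡ v ⊎ z ≡ y
    nbr-cases {z} x∼z with z ≟ᶠ v | z ≟ᶠ y
    ... | yes z≡v | _       = inj₁ z≡v
    ... | no _    | yes z≡y = inj₂ z≡y
    ... | no z≢v  | no z≢y  = contradiction (subst (3 ≤_) deg-x (length≤deg distinct adjacent)) (from-no (3 ≤? 2))
      where
      distinct : Unique (v ∷ y ∷ z ∷ [])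
      distinct = (y≢v ∘ sym ∷ z≢v ∘ sym ∷ []) ∷ (z≢y ∘ sym ∷ []) ∷ [] ∷ []
      adjacent : ∀ {u} → u ∈ v ∷ y ∷ z ∷ [] → x ∼ u
      adjacent (here refl)                 = x∼v
      adjacent (there (here refl))         = ∈-nbrs⁻ y∈
      adjacent (there (there (here refl))) = x∼z

  record ClassTwo (v w : Fin n) : Set where
    field
      deg₂Nbr     : Fin 2 → Fin n
      ∼deg₂Nbr    : ∀ t → v ∼ deg₂Nbr t
      deg-deg₂Nbr : ∀ t → deg G (deg₂Nbr t) ≡ 2
      nbr-cases   : ∀ {z} → v ∼ z → z ≡ w ⊎ ∃[ t ] z ≡ deg₂Nbr t

  classTwo : ∀ {v w} → OfClass G 2 v → deg G w ≡ 3 → v ∼ w → ClassTwo v w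
  classTwo {v} {w} (deg-v , class-v) deg-w v∼w
    with ∃∈-∉ {ys = []} (nbrs₂-unique v) (subst (0 <_) (trans (sym class-v) (deg2Nbrs≡length v)) (s≤s z≤n))
  ... | a , a∈ , _
    with ∃∈-∉ {ys = a ∷ []} (nbrs₂-unique v) (subst (1 <_) (trans (sym class-v) (deg2Nbrs≡length v)) ≤-refl)
  ... | b , b∈ , b∉ = record
    { deg₂Nbr = deg₂Nbr ; ∼deg₂Nbr = ∼deg₂Nbr ; deg-deg₂Nbr = deg-deg₂Nbr ; nbr-cases = nbr-cases }
    where
    deg₂Nbr : Fin 2 → Fin n
    deg₂Nbr 0F = a
    deg₂Nbr 1F = b
    ∼deg₂Nbr : ∀ t → v ∼ deg₂Nbr t
    ∼deg₂Nbr 0F = proj₁ (∈-nbrs₂⁻ a∈)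
    ∼deg₂Nbr 1F = proj₁ (∈-nbrs₂⁻ b∈)
    deg-deg₂Nbr : ∀ t → deg G (deg₂Nbr t) ≡ 2
    deg-deg₂Nbr 0F = proj₂ (∈-nbrs₂⁻ a∈)
    deg-deg₂Nbr 1F = proj₂ (∈-nbrs₂⁻ b∈)
    nbr-cases : ∀ {z} → v ∼ z → z ≡ w ⊎ ∃[ t ] z ≡ deg₂Nbr t
    nbr-cases {z} v∼z with z ≟ᶠ w | z ≟ᶠ a | z ≟ᶠ b
    ... | yes z≡w | _       | _       = inj₁ z≡w
    ... | no _    | yes z≡a | _       = inj₂ (0F , z≡a)
    ... | no _    | no _    | yes z≡b = inj₂ (1F , z≡b)
    ... | no z≢w  | no z≢a  | no z≢b  = contradiction (subst (4 ≤_) deg-v (length≤deg distinct adjacent)) (from-no (4 ≤? 3))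
      where
      distinct : Unique (w ∷ a ∷ b ∷ z ∷ [])
      distinct = (deg-3≢2 deg-w (deg-deg₂Nbr 0F) ∷ deg-3≢2 deg-w (deg-deg₂Nbr 1F) ∷ z≢w ∘ sym ∷ [])
               ∷ ((λ a≡b → b∉ (here (sym a≡b))) ∷ z≢a ∘ sym ∷ [])
               ∷ (z≢b ∘ sym ∷ []) ∷ [] ∷ []
      adjacent : ∀ {u} → u ∈ w ∷ a ∷ b ∷ z ∷ [] → v ∼ u
      adjacent (here refl)                         = v∼w
      adjacent (there (here refl))                 = ∼deg₂Nbr 0F
      adjacent (there (there (here refl)))         = ∼deg₂Nbr 1F
      adjacent (there (there (there (here refl)))) = v∼z

module Cycles {n} (G : Graph n) where

  open Neighbourhoods G using (_∼_; ∼-sym; ∼-irrefl)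

  GirthAtLeast-mono : ∀ {g g′} → g′ ≤ g → GirthAtLeast g G → GirthAtLeast g′ G
  GirthAtLeast-mono g′≤g girth l f cycle = ≤-trans g′≤g (girth l f cycle)

  girth≤length : ∀ {g} → GirthAtLeast g G → ∀ x xs → 3 ≤ length (x ∷ xs) → Unique (x ∷ xs) →
                 Linked _∼_ (x ∷ xs ++ x ∷ []) → g ≤ length (x ∷ xs)
  girth≤length girth x xs 3≤ distinct walk =
    girth (length (x ∷ xs)) (at x (x ∷ xs))
      (3≤ , (λ i → at-linked x walk) , at-length x (x ∷ xs) , λ i j → at-injective x distinct)

  -- x v w y is a path, so an edge or a common neighbour of x and y closes a cycle of length at most 5.
  ¬SqAdj-across-edge : GirthAtLeast 6 G → ∀ {v w x y} → v ∼ w → v ∼ x → w ∼ y → x ≢ w → y ≢ v →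
                       ¬ SqAdj (adj G) x y
  ¬SqAdj-across-edge girth {v} {w} {x} {y} v∼w v∼x w∼y x≢w y≢v (x≢y , inj₁ x∼y) =
    from-no (6 ≤? 4) (girth≤length girth v (w ∷ y ∷ x ∷ []) (s≤s (s≤s (s≤s z≤n)))
      ( (∼-irrefl v∼w ∷ y≢v ∘ sym ∷ ∼-irrefl v∼x ∷ [])
      ∷ (∼-irrefl w∼y ∷ x≢w ∘ sym ∷ [])
      ∷ (x≢y ∘ sym ∷ []) ∷ [] ∷ [])
      (v∼w ∷ w∼y ∷ ∼-sym x∼y ∷ ∼-sym v∼x ∷ [-]))
  ¬SqAdj-across-edge girth {v} {w} {x} {y} v∼w v∼x w∼y x≢w y≢v (x≢y , inj₂ (z , x∼z , z∼y)) =
    from-no (6 ≤? 5) (girth≤length girth v (w ∷ y ∷ z ∷ x ∷ []) (s≤s (s≤s (s≤s z≤n)))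
      ( (∼-irrefl v∼w ∷ y≢v ∘ sym ∷ v≢z ∷ ∼-irrefl v∼x ∷ [])
      ∷ (∼-irrefl w∼y ∷ w≢z ∷ x≢w ∘ sym ∷ [])
      ∷ (∼-irrefl z∼y ∘ sym ∷ x≢y ∘ sym ∷ [])
      ∷ (∼-irrefl x∼z ∘ sym ∷ []) ∷ [] ∷ [])
      (v∼w ∷ w∼y ∷ ∼-sym z∼y ∷ ∼-sym x∼z ∷ ∼-sym v∼x ∷ [-]))
    where
    v≢z : v ≢ z
    v≢z refl = from-no (6 ≤? 3) (girth≤length girth v (w ∷ y ∷ []) (s≤s (s≤s (s≤s z≤n)))
      ((∼-irrefl v∼w ∷ y≢v ∘ sym ∷ []) ∷ (∼-irrefl w∼y ∷ []) ∷ [] ∷ [])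
      (v∼w ∷ w∼y ∷ ∼-sym z∼y ∷ [-]))
    w≢z : w ≢ z
    w≢z refl = from-no (6 ≤? 3) (girth≤length girth v (w ∷ x ∷ []) (s≤s (s≤s (s≤s z≤n)))
      ((∼-irrefl v∼w ∷ ∼-irrefl v∼x ∷ []) ∷ (x≢w ∘ sym ∷ []) ∷ [] ∷ [])
      (v∼w ∷ ∼-sym x∼z ∷ ∼-sym v∼x ∷ [-]))

module Deletion {n} (G : Graph n) {D : Fin n → Set} (D? : Decidable D) where

  open Neighbourhoods G using (_∼_; ∼-sym; SqAdj-sym)

  remains : Fin n → Bool
  remains u = not (does (D? u))

  remains⁺ : ∀ {u} → ¬ D u → remains u ≡ true
  remains⁺ {u} ¬Du with D? u
  ... | yes Du = contradiction Du ¬Du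
  ... | no _   = refl

  ∧≡true⁻ : ∀ {a b} → a ∧ b ≡ true → a ≡ true × b ≡ true
  ∧≡true⁻ {true} b≡true = refl , b≡true

  ∧≡true⁺ : ∀ {a b} → a ≡ true → b ≡ true → a ∧ b ≡ true
  ∧≡true⁺ refl refl = refl

  G∖D : Subgraph G
  G∖D = record
    { vs     = remains
    ; es     = λ u v → adj G u v ∧ (remains u ∧ remains v)
    ; es-sym = λ u v → cong₂ _∧_ (Graph.sym G u v) (∧-comm (remains u) (remains v))
    ; es⊆adj = λ u v → proj₁ ∘ ∧≡true⁻
    ; es-vs  = λ u v → proj₁ ∘ ∧≡true⁻ ∘ proj₂ ∘ ∧≡true⁻ {adj G u v}
    }

  G∖D-proper : ∀ {u} → D u → Proper G∖D
  G∖D-proper {u} Du = inj₁ (u , removed)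
    where
    removed : remains u ≡ false
    removed with D? u
    ... | yes _  = refl
    ... | no ¬Du = contradiction Du ¬Du

  edge-G∖D : ∀ {a b} → ¬ D a → ¬ D b → a ∼ b → es G∖D a b ≡ true
  edge-G∖D ¬Da ¬Db a∼b = ∧≡true⁺ a∼b (∧≡true⁺ (remains⁺ ¬Da) (remains⁺ ¬Db))

  SqAdj-G∖D : (∀ {w u v} → D w → w ∼ u → w ∼ v → ¬ D u → ¬ D v → u ≡ v) →
              ∀ {u v} → ¬ D u → ¬ D v → SqAdj (adj G) u v → SqAdj (es G∖D) u v
  SqAdj-G∖D shared ¬Du ¬Dv (u≢v , inj₁ u∼v) = u≢v , inj₁ (edge-G∖D ¬Du ¬Dv u∼v)
  SqAdj-G∖D shared ¬Du ¬Dv (u≢v , inj₂ (w , u∼w , w∼v)) with D? w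
  ... | yes Dw  = contradiction (shared Dw (∼-sym u∼w) w∼v ¬Du ¬Dv) u≢v
  ... | no ¬Dw  = u≢v , inj₂ (w , edge-G∖D ¬Du ¬Dw u∼w , edge-G∖D ¬Dw ¬Dv w∼v)

  extend-colouring : ∀ {L : Fin n → List ℕ} (outer : Fin n → ℕ) (inner : ∀ u → D u → ℕ) →
    (∀ {u} → ¬ D u → outer u ∈ L u) →
    (∀ {u} (Du : D u) → inner u Du ∈ L u) →
    (∀ {u v} → ¬ D u → ¬ D v → SqAdj (adj G) u v → outer u ≢ outer v) →
    (∀ {u v} (Du : D u) (Dv : D v) → SqAdj (adj G) u v → inner u Du ≢ inner v Dv) →
    (∀ {u v} (Du : D u) → ¬ D v → SqAdj (adj G) u v → inner u Du ≢ outer v) →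
    Σ (Fin n → ℕ) λ c → (∀ u → c u ∈ L u) × (∀ {u v} → SqAdj (adj G) u v → c u ≢ c v)
  extend-colouring {L} outer inner outer∈ inner∈ outer-proper inner-proper mixed-proper = c , c∈ , proper
    where
    c : Fin n → ℕ
    c u with D? u
    ... | yes Du = inner u Du
    ... | no _   = outer u
    c∈ : ∀ u → c u ∈ L u
    c∈ u with D? u
    ... | yes Du  = inner∈ Du
    ... | no ¬Du  = outer∈ ¬Du
    proper : ∀ {u v} → SqAdj (adj G) u v → c u ≢ c v
    proper {u} {v} sq with D? u | D? v
    ... | yes Du | yes Dv = inner-proper Du Dv sq
    ... | yes Du | no ¬Dv = mixed-proper Du ¬Dv sq
    ... | no ¬Du | yes Dv = mixed-proper Dv ¬Du (SqAdj-sym sq) ∘ sym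
    ... | no ¬Du | no ¬Dv = outer-proper ¬Du ¬Dv sq

module Configuration {n} (G : Graph n) (Δ≤3 : MaxDegAtMost 3 G) (girth : GirthAtLeast 6 G)
  (v₁ v₂ : Fin n) (v₁∼v₂ : adj G v₁ v₂ ≡ true) (class₁ : OfClass G 2 v₁) (class₂ : OfClass G 2 v₂) where

  open Neighbourhoods G
  open Cycles G using (¬SqAdj-across-edge)
  open ListChoice (_≟ᶠ_ {n}) using (remove; length-remove<; ∈-remove⁺)
  open ClassTwo
  open OtherNeighbour

  hubV : Fin 2 → Fin n
  hubV 0F = v₁
  hubV 1F = v₂

  opp : Fin 2 → Fin 2
  opp 0F = 1F
  opp 1F = 0F

  hub-class : ∀ h → OfClass G 2 (hubV h)
  hub-class 0F = class₁
  hub-class 1F = class₂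

  hub∼opp : ∀ h → hubV h ∼ hubV (opp h)
  hub∼opp 0F = v₁∼v₂
  hub∼opp 1F = ∼-sym v₁∼v₂

  opaque
    star : ∀ h → ClassTwo (hubV h) (hubV (opp h))
    star h = classTwo (hub-class h) (proj₁ (hub-class (opp h))) (hub∼opp h)

  σ : Slot → Fin n
  σ (hub h)    = hubV h
  σ (leaf s t) = deg₂Nbr (star s) t

  leaf≢hub : ∀ s t h → σ (leaf s t) ≢ hubV h
  leaf≢hub s t h = deg-3≢2 (proj₁ (hub-class h)) (deg-deg₂Nbr (star s) t) ∘ sym

  opaque
    link : ∀ s t → OtherNeighbour (σ (leaf s t)) (hubV s)
    link s t = otherNeighbour (deg-deg₂Nbr (star s) t) (∼-sym (∼deg₂Nbr (star s) t))

  Core : Fin n → Set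
  Core u = ∃[ i ] σ i ≡ u

  allSlots : List Slot
  allSlots = hub 0F ∷ hub 1F ∷ leaf 0F 0F ∷ leaf 0F 1F ∷ leaf 1F 0F ∷ leaf 1F 1F ∷ []

  ∈-allSlots : ∀ i → i ∈ allSlots
  ∈-allSlots (hub 0F)     = here refl
  ∈-allSlots (hub 1F)     = there (here refl)
  ∈-allSlots (leaf 0F 0F) = there (there (here refl))
  ∈-allSlots (leaf 0F 1F) = there (there (there (here refl)))
  ∈-allSlots (leaf 1F 0F) = there (there (there (there (here refl))))
  ∈-allSlots (leaf 1F 1F) = there (there (there (there (there (here refl)))))

  core? : Decidable Core
  core? u = Dec.map′ Any.satisfied (λ (i , σi≡u) → lose (∈-allSlots i) σi≡u)
                     (Any.any? (λ i → σ i ≟ᶠ u) allSlots)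

  open Deletion G core? public using () renaming (G∖D to G∖core; G∖D-proper to G∖core-proper)
  open Deletion G core? using (remains⁺; SqAdj-G∖D; extend-colouring)

  hub-nbr-core : ∀ h {u} → hubV h ∼ u → Core u
  hub-nbr-core h hub∼u with nbr-cases (star h) hub∼u
  ... | inj₁ u≡opp       = hub (opp h) , sym u≡opp
  ... | inj₂ (t , u≡leaf) = leaf h t , sym u≡leaf

  leaf-nbr : ∀ s t {u} → σ (leaf s t) ∼ u → ¬ Core u → u ≡ far (link s t)
  leaf-nbr s t leaf∼u ¬core with nbr-cases (link s t) leaf∼u
  ... | inj₁ refl  = contradiction (hub s , refl) ¬core
  ... | inj₂ u≡far = u≡far

  shared-core-nbr : ∀ {w u v} → Core w → w ∼ u → w ∼ v → ¬ Core u → ¬ Core v → u ≡ v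
  shared-core-nbr (hub h , refl) w∼u _ ¬core _ = contradiction (hub-nbr-core h w∼u) ¬core
  shared-core-nbr (leaf s t , refl) w∼u w∼v ¬core-u ¬core-v =
    trans (leaf-nbr s t w∼u ¬core-u) (sym (leaf-nbr s t w∼v ¬core-v))

  near : Slot → List (Fin n)
  near (hub h)    = far (link h 0F) ∷ far (link h 1F) ∷ []
  near (leaf s t) = far (link s t) ∷ remove (σ (leaf s t)) (nbrs (far (link s t)))

  slotSize+near≤6 : ∀ i → slotSize i + length (near i) ≤ 6
  slotSize+near≤6 (hub h)    = ≤-refl
  slotSize+near≤6 (leaf s t) =
    +-monoʳ-≤ 3 (≤-trans (length-remove< leaf∈) (subst (_≤ 3) (deg≡length-nbrs x′) (Δ≤3 x′)))
    where
    x′ = far (link s t)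
    leaf∈ : σ (leaf s t) ∈ nbrs x′
    leaf∈ = ∈-nbrs⁺ (∼-sym (x∼far (link s t)))

  near-complete : ∀ i {u} → ¬ Core u → SqAdj (adj G) (σ i) u → u ∈ near i
  near-complete (hub h) ¬core (_ , inj₁ hub∼u) = contradiction (hub-nbr-core h hub∼u) ¬core
  near-complete (hub h) ¬core (_ , inj₂ (w , hub∼w , w∼u)) with nbr-cases (star h) hub∼w
  ... | inj₁ refl        = contradiction (hub-nbr-core (opp h) w∼u) ¬core
  ... | inj₂ (0F , refl) = here (leaf-nbr h 0F w∼u ¬core)
  ... | inj₂ (1F , refl) = there (here (leaf-nbr h 1F w∼u ¬core))
  near-complete (leaf s t) ¬core (_ , inj₁ leaf∼u) = here (leaf-nbr s t leaf∼u ¬core)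
  near-complete (leaf s t) ¬core (leaf≢u , inj₂ (w , leaf∼w , w∼u)) with nbr-cases (link s t) leaf∼w
  ... | inj₁ refl = contradiction (hub-nbr-core s w∼u) ¬core
  ... | inj₂ refl = there (∈-remove⁺ (∈-nbrs⁺ w∼u) leaf≢u)

  leaves-apart : ∀ s t t′ → ¬ SqAdj (adj G) (σ (leaf s t)) (σ (leaf (opp s) t′))
  leaves-apart s t t′ = ¬SqAdj-across-edge girth (hub∼opp s) (∼deg₂Nbr (star s) t) (∼deg₂Nbr (star (opp s)) t′)
                          (leaf≢hub s t (opp s)) (leaf≢hub (opp s) t′ s)

  hub-clash : ∀ h h′ → h ≢ h′ → Clash (hub h) (hub h′) ⊎ Clash (hub h′) (hub h)
  hub-clash 0F 0F h≢h′ = contradiction refl h≢h′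
  hub-clash 0F 1F _    = inj₁ hub-hub
  hub-clash 1F 0F _    = inj₂ hub-hub
  hub-clash 1F 1F h≢h′ = contradiction refl h≢h′

  twin-clash : ∀ s t t′ → t ≢ t′ → Clash (leaf s t) (leaf s t′) ⊎ Clash (leaf s t′) (leaf s t)
  twin-clash s 0F 0F t≢t′ = contradiction refl t≢t′
  twin-clash s 0F 1F _    = inj₁ (leaf-leaf s)
  twin-clash s 1F 0F _    = inj₂ (leaf-leaf s)
  twin-clash s 1F 1F t≢t′ = contradiction refl t≢t′

  clash : ∀ i j → SqAdj (adj G) (σ i) (σ j) → Clash i j ⊎ Clash j i
  clash (hub h)     (hub h′)     sq = hub-clash h h′ (proj₁ sq ∘ cong hubV)
  clash (hub h)     (leaf s t)   _  = inj₁ (hub-leaf h s t)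
  clash (leaf s t)  (hub h)      _  = inj₂ (hub-leaf h s t)
  clash (leaf 0F t) (leaf 0F t′) sq = twin-clash 0F t t′ (proj₁ sq ∘ cong (σ ∘ leaf 0F))
  clash (leaf 1F t) (leaf 1F t′) sq = twin-clash 1F t t′ (proj₁ sq ∘ cong (σ ∘ leaf 1F))
  clash (leaf 0F t) (leaf 1F t′) sq = contradiction sq (leaves-apart 0F t t′)
  clash (leaf 1F t) (leaf 0F t′) sq = contradiction sq (leaves-apart 1F t t′)

  module _ {L : Fin n → List ℕ} (lists : ∀ u → length (L u) ≡ 6 × Unique (L u)) (outer : Fin n → ℕ) where

    open ListChoice ℕ._≟_ using (Selection; select)
    open TwinK₄ ℕ._≟_ using (twinK₄-choosable)
    open Selection

    opaque
      available : ∀ i → Selection (slotSize i) (L (σ i)) (map outer (near i))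
      available i = select (slotSize i) (map outer (near i)) (proj₂ (lists (σ i)))
        (subst₂ (λ m k → slotSize i + m ≤ k) (sym (length-map outer (near i))) (sym (proj₁ (lists (σ i))))
                (slotSize+near≤6 i))

    colour-core : Σ (Slot → ℕ) λ col →
      (∀ i → col i ∈ L (σ i)) ×
      (∀ i {u} → ¬ Core u → SqAdj (adj G) (σ i) u → col i ≢ outer u) ×
      (∀ {i j} → Clash i j → col i ≢ col j)
    colour-core with twinK₄-choosable (elems ∘ available) (elems-unique ∘ available) (length-elems ∘ available)
    ... | col , col∈ , col-proper = col , elems⊆ (available _) ∘ col∈ , avoids-outer , col-proper
      where
      avoids-outer : ∀ i {u} → ¬ Core u → SqAdj (adj G) (σ i) u → col i ≢ outer u
      avoids-outer i ¬core sq col≡outer =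
        elems∉ (available i) (col∈ i)
          (subst (_∈ map outer (near i)) (sym col≡outer) (∈-map⁺ outer (near-complete i ¬core sq)))

  reducible : SubSquareChoosable 6 G∖core → SquareChoosable 6 G
  reducible choosable L lists
    with choosable L (λ u _ → lists u refl)
  ... | outer , outer∈ , outer-proper
    with colour-core (λ u → lists u refl) outer
  ... | col , col∈ , col≢outer , col-proper =
    let c , c∈ , c-proper = extend-colouring outer inner (outer∈ _ ∘ remains⁺) inner∈
                              outer-proper′ inner-proper mixed-proper
    in c , (λ u _ → c∈ u) , (λ u v _ _ → c-proper)
    where
    outer-proper′ : ∀ {u v} → ¬ Core u → ¬ Core v → SqAdj (adj G) u v → outer u ≢ outer v
    outer-proper′ ¬Cu ¬Cv = outer-proper _ _ (remains⁺ ¬Cu) (remains⁺ ¬Cv) ∘ SqAdj-G∖D shared-core-nbr ¬Cu ¬Cv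
    inner : ∀ u → Core u → ℕ
    inner _ (i , _) = col i
    inner∈ : ∀ {u} (Cu : Core u) → inner u Cu ∈ L u
    inner∈ (i , refl) = col∈ i
    inner-proper : ∀ {u v} (Cu : Core u) (Cv : Core v) → SqAdj (adj G) u v → inner u Cu ≢ inner v Cv
    inner-proper (i , refl) (j , refl) sq = [ col-proper , (λ j-i → col-proper j-i ∘ sym) ] (clash i j sq)
    mixed-proper : ∀ {u v} (Cu : Core u) → ¬ Core v → SqAdj (adj G) u v → inner u Cu ≢ outer v
    mixed-proper (i , refl) = col≢outer i

lemma16 : ∀ (n : ℕ) (G : Graph n) →
    Minimal 6 G → MaxDegAtMost 3 G → GirthAtLeast 7 G →
    ¬ (Σ (Fin n) λ v₁ → Σ (Fin n) λ v₂ →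
    adj G v₁ v₂ ≡ true × OfClass G 2 v₁ × OfClass G 2 v₂)
lemma16 n G (not-choosable , minimal) Δ≤3 girth≥7 (v₁ , v₂ , v₁∼v₂ , class₁ , class₂) =
  not-choosable (reducible (minimal G∖core (G∖core-proper (hub 0F , refl))))
  where
  open Configuration G Δ≤3 (Cycles.GirthAtLeast-mono G (n≤1+n 6) girth≥7) v₁ v₂ v₁∼v₂ class₁ class₂
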